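{- Let $\Delta \ge 1$ be an integer. For every finite simple graph $G$ with maximum degree $\Delta$, \[ \alpha(G) \;\ge\; \mathrm{CW}(G) \;\ge\; \frac{2}{\Delta+1}\,\alpha(G), \] that is, the Caro–Wei bound has performance ratio $(\Delta+1)/2$. Moreover, this ratio cannot be improved: for every $\Delta \ge 1$ there exist graphs $G$ of maximum degree $\Delta$ with $\alpha(G) = \frac{\Delta+1}{2}\,\mathrm{CW}(G)$.
   Context: For a finite simple graph $G=(V,E)$, $\alpha(G)$ denotes the maximum cardinality of an independent set in $G$, $d(v)$ is the degree of vertex $v$, and the Caro–Wei bound is $\mathrm{CW}(G) = \sum_{v\in V} \frac{1}{d(v)+1}$. A bound $B(G)$ is said to have performance ratio $f(\Delta)$ if for all graphs $G$ with maximum degree $\Delta$ it holds that $\alpha(G) \ge B(G) \ge \alpha(G)/f(\Delta)$. -}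

module Defs where

open import Data.Nat using (ℕ; zero; suc; _≤_)
open import Data.Bool using (Bool; true; false)
open import Data.Fin using (Fin)
open import Data.Fin.Subset using (Subset; _∈_; ∣_∣)
open import Data.List using (List; map; sum; length; filter)
open import Data.List using () renaming (allFin to allFinL)
open import Data.Product using (Σ; ∃; _×_; _,_)
open import Relation.Binary.PropositionalEquality using (_≡_)
open import Relation.Nullary using (¬_)
open import Data.Integer using (+_)
open import Data.Rational using (ℚ; _/_; 0ℚ; _+_)

record Graph (n : ℕ) : Set where
  field
    adj     : Fin n → Fin n → Bool
    symm    : ∀ u v → adj u v ≡ adj v u
    irrefl  : ∀ v → adj v v ≡ false
open Graph public

degree : ∀ {n} → Graph n → Fin n → ℕ
degree {n} G v = length (filter (λ u → Data.Bool._≟_ (adj G v u) true) (allFinL n))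
  where import Data.Bool

HasMaxDegree : ∀ {n} → Graph n → ℕ → Set
HasMaxDegree {n} G Δ = (∀ v → degree G v ≤ Δ) × ∃ λ v → degree G v ≡ Δ

Independent : ∀ {n} → Graph n → Subset n → Set
Independent G S = ∀ u v → u ∈ S → v ∈ S → adj G u v ≡ false

IsIndependenceNumber : ∀ {n} → Graph n → ℕ → Set
IsIndependenceNumber {n} G k =
  (∃ λ (S : Subset n) → Independent G S × ∣ S ∣ ≡ k)
  × (∀ (S : Subset n) → Independent G S → ∣ S ∣ ≤ k)

CW : ∀ {n} → Graph n → ℚ
CW {n} G = sumℚ (map (λ v → (+ 1) / suc (degree G v)) (allFinL n))
  where
  sumℚ : List ℚ → ℚ
  sumℚ = Data.List.foldr _+_ 0ℚ

-- CW ≤ α: repeatedly take a vertex v of minimum degree in the remaining induced subgraph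
-- into the independent set and delete its closed neighbourhood N[v]. Each of the
-- d(v) + 1 deleted vertices u contributed 1/(d(u)+1) ≤ 1/(d(v)+1), and the degrees of the
-- surviving vertices only drop, so every step lowers the Caro–Wei sum of the remaining
-- subgraph by at most 1.
--
-- 2α/(Δ+1) ≤ CW: for an independent set S weight v by 2Δ − d(v) if v ∈ S and by d(v)
-- otherwise. All edges at S leave S, so Σ_{v∈S} d(v) ≤ Σ_{v∉S} d(v) and the weights add
-- up to at least 2Δ|S|; and each weight is at most Δ(Δ+1)/(d(v)+1), because
-- (2Δ − d)(d + 1) ≤ Δ(Δ + 1) for d ≤ Δ.
--
-- K_{Δ,Δ} attains the bound: α = Δ and CW = 2Δ/(Δ+1).

module Submission where

module CaroWei where

  import Algebra.Properties.CommutativeMonoid.Sum as CommutativeMonoidSum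
  open import Data.Bool as Bool using (Bool; true; false; not; _∧_; _∨_; _xor_; if_then_else_)
  open import Data.Bool.Properties
    using (∧-conicalˡ; ∧-conicalʳ; not-injective; ¬-not; xor-comm; xor-same; not-distribˡ-xor)
  open import Data.Fin using (Fin; zero; suc; toℕ; _≟_)
  open import Data.Fin.Properties using (any?)
  open import Data.Fin.Subset using (Subset; ∣_∣)
  import Data.Integer.Base as ℤ
  import Data.Integer.Properties as ℤ
  open import Data.List.Base using (filter; length; tabulate; foldr; map)
  open import Data.Nat.Base using (ℕ; zero; suc; _+_; _*_; _∸_; _≤_; _<_; z≤n; s≤s; NonZero)
  import Data.Nat.Properties as ℕ
  open import Data.Nat.Tactic.RingSolver using (solve-∀)
  open import Data.Product using (∃-syntax; _×_; _,_; proj₁; proj₂)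
  open import Data.Rational.Base as ℚ using (ℚ; toℚᵘ)
  import Data.Rational.Properties as ℚ
  open import Data.Rational.Unnormalised.Base using (ℚᵘ; *≤*; *≡*; 0ℚᵘ)
    renaming (_≤_ to _≤ᵘ_; _≃_ to _≃ᵘ_; _+_ to _+ᵘ_; _*_ to _*ᵘ_; _/_ to _/ᵘ_)
  import Data.Rational.Unnormalised.Properties as ℚᵘ
  open import Data.Sum.Base using (_⊎_; inj₁; inj₂)
  open import Data.Vec.Base as Vec using ([]; _∷_; lookup)
  import Data.Vec.Properties as Vec
  open import Defs
  open import Function.Base using (_∘_; const)
  open import Relation.Binary.PropositionalEquality
  open import Relation.Nullary using (does; yes; no; contradiction)

  open import Algebra.Properties.Semiring.Sum ℕ.+-*-semiring
    using (sum; sum-syntax; sum-cong-≗; sum-replicate-zero; ∑-distrib-+; ∑-comm; *-distribˡ-sum)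
  open CommutativeMonoidSum ℚᵘ.+-0-commutativeMonoid
    using () renaming (sum to ∑ᵘ; sum-cong-≋ to ∑ᵘ-cong; ∑-distrib-+ to ∑ᵘ-distrib-+)

  ∑-mono-≤ : ∀ {n} {f g : Fin n → ℕ} → (∀ i → f i ≤ g i) → sum f ≤ sum g
  ∑-mono-≤ {zero}  f≤g = z≤n
  ∑-mono-≤ {suc n} f≤g = ℕ.+-mono-≤ (f≤g zero) (∑-mono-≤ (f≤g ∘ suc))

  ∑ᵘ-mono-≤ : ∀ {n} {f g : Fin n → ℚᵘ} → (∀ i → f i ≤ᵘ g i) → ∑ᵘ f ≤ᵘ ∑ᵘ g
  ∑ᵘ-mono-≤ {zero}  f≤g = ℚᵘ.≤-refl
  ∑ᵘ-mono-≤ {suc n} f≤g = ℚᵘ.+-mono-≤ (f≤g zero) (∑ᵘ-mono-≤ (f≤g ∘ suc))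

  𝟙 : Bool → ℕ
  𝟙 true  = 1
  𝟙 false = 0

  count : ∀ {n} → (Fin n → Bool) → ℕ
  count {n} P = ∑[ u < n ] 𝟙 (P u)

  𝟙-mono : ∀ {a b} → (a ≡ true → b ≡ true) → 𝟙 a ≤ 𝟙 b
  𝟙-mono {false} _   = z≤n
  𝟙-mono {true}  a⇒b rewrite a⇒b refl = ℕ.≤-refl

  𝟙-∧-split : ∀ a b → 𝟙 a ≡ 𝟙 (a ∧ b) + 𝟙 (a ∧ not b)
  𝟙-∧-split false _     = refl
  𝟙-∧-split true  true  = refl
  𝟙-∧-split true  false = refl

  ∑-𝟙-≟ : ∀ {n} (v : Fin n) → ∑[ u < n ] 𝟙 (does (u ≟ v)) ≡ 1
  ∑-𝟙-≟ {suc n} zero    = cong suc (sum-replicate-zero n)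
  ∑-𝟙-≟ {suc n} (suc v) = ∑-𝟙-≟ v

  count-∅ : ∀ {n} {P : Fin n → Bool} → (∀ u → P u ≡ false) → count P ≡ 0
  count-∅ {n} P≡false = trans (sum-cong-≗ (cong 𝟙 ∘ P≡false)) (sum-replicate-zero n)

  count-const-true : ∀ n → count {n} (const true) ≡ n
  count-const-true zero    = refl
  count-const-true (suc n) = cong suc (count-const-true n)

  ∣∣≡count : ∀ {n} (S : Subset n) → ∣ S ∣ ≡ count (lookup S)
  ∣∣≡count []          = refl
  ∣∣≡count (true ∷ S)  = cong suc (∣∣≡count S)
  ∣∣≡count (false ∷ S) = ∣∣≡count S

  ∣tabulate∣≡count : ∀ {n} (T : Fin n → Bool) → ∣ Vec.tabulate T ∣ ≡ count T
  ∣tabulate∣≡count T = trans (∣∣≡count (Vec.tabulate T)) (sum-cong-≗ (cong 𝟙 ∘ Vec.lookup∘tabulate T))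

  length-filter-tabulate : ∀ {A : Set} {n} (p : A → Bool) (f : Fin n → A) →
    length (filter (λ x → p x Bool.≟ true) (tabulate f)) ≡ ∑[ i < n ] 𝟙 (p (f i))
  length-filter-tabulate {n = zero}  p f = refl
  length-filter-tabulate {n = suc n} p f with p (f zero)
  ... | true  = cong suc (length-filter-tabulate p (f ∘ suc))
  ... | false = length-filter-tabulate p (f ∘ suc)

  degree≡count : ∀ {n} (G : Graph n) v → degree G v ≡ count (adj G v)
  degree≡count G v = length-filter-tabulate (adj G v) (λ u → u)

  infix 8 _÷_

  _÷_ : ℕ → (d : ℕ) .{{_ : NonZero d}} → ℚᵘ
  a ÷ d = ℤ.+ a /ᵘ d

  ÷-mono-≤ : ∀ {a b c d} .{{_ : NonZero b}} .{{_ : NonZero d}} → a * d ≤ c * b → a ÷ b ≤ᵘ c ÷ d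
  ÷-mono-≤ {a} {suc b} {c} {suc d} ad≤cb =
    *≤* (subst₂ ℤ._≤_ (ℤ.pos-* a (suc d)) (ℤ.pos-* c (suc b)) (ℤ.+≤+ ad≤cb))

  ÷-monoˡ-≤ : ∀ {a c} d .{{_ : NonZero d}} → a ≤ c → a ÷ d ≤ᵘ c ÷ d
  ÷-monoˡ-≤ d a≤c = ÷-mono-≤ (ℕ.*-monoˡ-≤ d a≤c)

  ÷-cong : ∀ {a b c d} .{{_ : NonZero b}} .{{_ : NonZero d}} → a * d ≡ c * b → a ÷ b ≃ᵘ c ÷ d
  ÷-cong {a} {suc b} {c} {suc d} ad≡cb =
    *≡* (trans (sym (ℤ.pos-* a (suc d))) (trans (cong ℤ.+_ ad≡cb) (ℤ.pos-* c (suc b))))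

  0÷≃0 : ∀ d .{{_ : NonZero d}} → 0 ÷ d ≃ᵘ 0ℚᵘ
  0÷≃0 (suc d) = *≡* refl

  0÷-identityˡ : ∀ d .{{_ : NonZero d}} x → 0 ÷ d +ᵘ x ≃ᵘ x
  0÷-identityˡ d x = ℚᵘ.≃-trans (ℚᵘ.+-congˡ x (0÷≃0 d)) (ℚᵘ.+-identityˡ x)

  0÷-identityʳ : ∀ d .{{_ : NonZero d}} x → x +ᵘ 0 ÷ d ≃ᵘ x
  0÷-identityʳ d x = ℚᵘ.≃-trans (ℚᵘ.+-congʳ x (0÷≃0 d)) (ℚᵘ.+-identityʳ x)

  ÷-+ : ∀ a c d .{{_ : NonZero d}} → a ÷ d +ᵘ c ÷ d ≃ᵘ (a + c) ÷ d
  ÷-+ a c (suc d) = begin-equality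
    a ÷ suc d +ᵘ c ÷ suc d
      ≡⟨ cong (_/ᵘ (suc d * suc d)) (trans (cong₂ ℤ._+_ (sym (ℤ.pos-* a (suc d))) (sym (ℤ.pos-* c (suc d))))
                                           (sym (ℤ.pos-+ (a * suc d) (c * suc d)))) ⟩
    (a * suc d + c * suc d) ÷ (suc d * suc d)
      ≃⟨ ÷-cong (distrib a c (suc d)) ⟩
    (a + c) ÷ suc d ∎
    where
    open ℚᵘ.≤-Reasoning
    distrib : ∀ a c e → (a * e + c * e) * e ≡ (a + c) * (e * e)
    distrib = solve-∀

  ÷-* : ∀ a b c d → (a ÷ suc b) *ᵘ (c ÷ suc d) ≡ (a * c) ÷ (suc b * suc d)
  ÷-* a b c d = cong (_/ᵘ (suc b * suc d)) (sym (ℤ.pos-* a c))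

  ∑ᵘ-÷ : ∀ {n} (f : Fin n → ℕ) d .{{_ : NonZero d}} → ∑ᵘ (λ i → f i ÷ d) ≃ᵘ sum f ÷ d
  ∑ᵘ-÷ {zero}  f d = ℚᵘ.≃-sym (0÷≃0 d)
  ∑ᵘ-÷ {suc n} f d = ℚᵘ.≃-trans (ℚᵘ.+-congʳ (f zero ÷ d) (∑ᵘ-÷ (f ∘ suc) d)) (÷-+ (f zero) _ d)

  toℚᵘ-/ : ∀ a d .{{_ : NonZero d}} → toℚᵘ (ℤ.+ a ℚ./ d) ≃ᵘ a ÷ d
  toℚᵘ-/ a (suc d) = ℚ.toℚᵘ-fromℚᵘ (a ÷ suc d)

  toℚᵘ-foldr-+ : ∀ {A : Set} {n} (g : A → ℚ) (f : Fin n → A) →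
    toℚᵘ (foldr ℚ._+_ ℚ.0ℚ (map g (tabulate f))) ≃ᵘ ∑ᵘ (λ i → toℚᵘ (g (f i)))
  toℚᵘ-foldr-+ {n = zero}  g f = ℚᵘ.≃-refl
  toℚᵘ-foldr-+ {n = suc n} g f =
    ℚᵘ.≃-trans (ℚ.toℚᵘ-homo-+ (g (f zero)) _)
               (ℚᵘ.+-congʳ (toℚᵘ (g (f zero))) (toℚᵘ-foldr-+ g (f ∘ suc)))

  minimiser : ∀ {n} (P : Fin n → Bool) (f : Fin n → ℕ) →
    (∀ u → P u ≡ false) ⊎ ∃[ v ] (P v ≡ true × ∀ u → P u ≡ true → f v ≤ f u)
  minimiser {zero}  P f = inj₁ λ ()
  minimiser {suc n} P f with minimiser (P ∘ suc) (f ∘ suc) | P zero in P0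
  ... | inj₁ none | false = inj₁ λ { zero → P0 ; (suc u) → none u }
  ... | inj₁ none | true  =
    inj₂ (zero , P0 , λ { zero _ → ℕ.≤-refl ; (suc u) Pu → contradiction (trans (sym Pu) (none u)) λ () })
  ... | inj₂ (v , Pv , v-min) | false =
    inj₂ (suc v , Pv , λ { zero P0′ → contradiction (trans (sym P0′) P0) λ () ; (suc u) Pu → v-min u Pu })
  ... | inj₂ (v , Pv , v-min) | true with ℕ.≤-total (f zero) (f (suc v))
  ...   | inj₁ f0≤fv = inj₂ (zero , P0 , λ { zero _ → ℕ.≤-refl ; (suc u) Pu → ℕ.≤-trans f0≤fv (v-min u Pu) })
  ...   | inj₂ fv≤f0 = inj₂ (suc v , Pv , λ { zero _ → fv≤f0 ; (suc u) Pu → v-min u Pu })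

  𝟙÷-≤-split : ∀ w m {d d′ e} → d′ ≤ d → (w ≡ true → m ≡ true → e ≤ d) →
    𝟙 w ÷ suc d ≤ᵘ 𝟙 (w ∧ m) ÷ suc e +ᵘ 𝟙 (w ∧ not m) ÷ suc d′
  𝟙÷-≤-split false m {d} {d′} {e} _ _ =
    ℚᵘ.≤-respʳ-≃ (ℚᵘ.≃-sym (0÷-identityˡ (suc e) (0 ÷ suc d′)))
      (÷-mono-≤ {0} {suc d} {0} {suc d′} z≤n)
  𝟙÷-≤-split true true {d′ = d′} {e} _ e≤d =
    ℚᵘ.≤-respʳ-≃ (ℚᵘ.≃-sym (0÷-identityʳ (suc d′) (1 ÷ suc e)))
      (÷-mono-≤ (ℕ.*-monoʳ-≤ 1 (s≤s (e≤d refl refl))))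
  𝟙÷-≤-split true false {d′ = d′} {e} d′≤d _ =
    ℚᵘ.≤-respʳ-≃ (ℚᵘ.≃-sym (0÷-identityˡ (suc e) (1 ÷ suc d′)))
      (÷-mono-≤ (ℕ.*-monoʳ-≤ 1 (s≤s d′≤d)))

  [Δ+Δ∸d]*[1+d]≤Δ*[1+Δ] : ∀ {Δ d} → d ≤ Δ → (Δ + Δ ∸ d) * suc d ≤ Δ * suc Δ
  [Δ+Δ∸d]*[1+d]≤Δ*[1+Δ] {d = d} d≤Δ with ℕ.m≤n⇒∃[o]m+o≡n d≤Δ
  ... | e , refl = subst (λ a → a * suc d ≤ (d + e) * suc (d + e)) (sym Δ+Δ∸d) (bound e)
    where
    Δ+Δ∸d : d + e + (d + e) ∸ d ≡ e + (d + e)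
    Δ+Δ∸d = trans (cong (_∸ d) (ℕ.+-assoc d e (d + e))) (ℕ.m+n∸m≡n d (e + (d + e)))
    -- with Δ = d + e:  (2Δ − d)(d + 1) + e(e − 1) = Δ(Δ + 1)
    bound : ∀ e → (e + (d + e)) * suc d ≤ (d + e) * suc (d + e)
    bound zero    = ℕ.≤-reflexive (identity d)
      where
      identity : ∀ d → (0 + (d + 0)) * suc d ≡ (d + 0) * suc (d + 0)
      identity = solve-∀
    bound (suc f) = ℕ.≤-trans (ℕ.m≤m+n _ (f * suc f)) (ℕ.≤-reflexive (identity d f))
      where
      identity : ∀ d f → (suc f + (d + suc f)) * suc d + f * suc f ≡ (d + suc f) * suc (d + suc f)
      identity = solve-∀

  _⊆_ : ∀ {n} → (Fin n → Bool) → (Fin n → Bool) → Set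
  P ⊆ Q = ∀ u → P u ≡ true → Q u ≡ true

  module _ {n} (G : Graph n) where

    Independentᵇ : (Fin n → Bool) → Set
    Independentᵇ T = ∀ u w → T u ≡ true → T w ≡ true → adj G u w ≡ false

    degreeIn : (Fin n → Bool) → Fin n → ℕ
    degreeIn W v = count (λ u → W u ∧ adj G v u)

    cwIn : (Fin n → Bool) → ℚᵘ
    cwIn W = ∑ᵘ (λ v → 𝟙 (W v) ÷ suc (degreeIn W v))

    closedNbhd : Fin n → Fin n → Bool
    closedNbhd v u = does (u ≟ v) ∨ adj G v u

    degreeIn-mono : ∀ {W′ W} → W′ ⊆ W → ∀ v → degreeIn W′ v ≤ degreeIn W v
    degreeIn-mono W′⊆W v = ∑-mono-≤ λ u → 𝟙-mono λ h →
      cong₂ _∧_ (W′⊆W u (∧-conicalˡ _ _ h)) (∧-conicalʳ _ _ h)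

    count-closedNbhd : ∀ W v → W v ≡ true → count (λ u → W u ∧ closedNbhd v u) ≡ suc (degreeIn W v)
    count-closedNbhd W v v∈W = begin
      count (λ u → W u ∧ closedNbhd v u)
        ≡⟨ sum-cong-≗ split ⟩
      ∑[ u < n ] (𝟙 (does (u ≟ v)) + 𝟙 (W u ∧ adj G v u))
        ≡⟨ ∑-distrib-+ (λ u → 𝟙 (does (u ≟ v))) _ ⟩
      ∑[ u < n ] 𝟙 (does (u ≟ v)) + degreeIn W v
        ≡⟨ cong (_+ degreeIn W v) (∑-𝟙-≟ v) ⟩
      suc (degreeIn W v) ∎
      where
      open ≡-Reasoning
      split : ∀ u → 𝟙 (W u ∧ closedNbhd v u) ≡ 𝟙 (does (u ≟ v)) + 𝟙 (W u ∧ adj G v u)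
      split u with u ≟ v
      ... | yes refl rewrite v∈W | irrefl G u = refl
      ... | no _ = refl

    module RemoveClosedNbhd (W : Fin n → Bool) (v : Fin n) (v∈W : W v ≡ true) where

      W′ : Fin n → Bool
      W′ u = W u ∧ not (closedNbhd v u)

      count-W : count W ≡ suc (degreeIn W v) + count W′
      count-W = begin
        count W
          ≡⟨ sum-cong-≗ (λ u → 𝟙-∧-split (W u) (closedNbhd v u)) ⟩
        ∑[ u < n ] (𝟙 (W u ∧ closedNbhd v u) + 𝟙 (W′ u))
          ≡⟨ ∑-distrib-+ (λ u → 𝟙 (W u ∧ closedNbhd v u)) _ ⟩
        count (λ u → W u ∧ closedNbhd v u) + count W′
          ≡⟨ cong (_+ count W′) (count-closedNbhd W v v∈W) ⟩
        suc (degreeIn W v) + count W′ ∎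
        where open ≡-Reasoning

      W′⇒∉N[v] : ∀ {u} → W′ u ≡ true → u ≢ v × adj G v u ≡ false
      W′⇒∉N[v] {u} u∈W′ with u ≟ v | not-injective {y = false} (∧-conicalʳ (W u) _ u∈W′)
      ... | no u≢v | nonadjacent = u≢v , nonadjacent

      cwIn-≤ : (∀ u → W u ≡ true → degreeIn W v ≤ degreeIn W u) → cwIn W ≤ᵘ 1 ÷ 1 +ᵘ cwIn W′
      cwIn-≤ v-min = begin
        cwIn W
          ≤⟨ ∑ᵘ-mono-≤ (λ u → 𝟙÷-≤-split (W u) (closedNbhd v u) (degreeIn-mono W′⊆W u) (λ u∈W _ → v-min u u∈W)) ⟩
        ∑ᵘ (λ u → 𝟙 (W u ∧ closedNbhd v u) ÷ suc (degreeIn W v) +ᵘ 𝟙 (W′ u) ÷ suc (degreeIn W′ u))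
          ≃⟨ ∑ᵘ-distrib-+ (λ u → 𝟙 (W u ∧ closedNbhd v u) ÷ suc (degreeIn W v)) _ ⟩
        ∑ᵘ (λ u → 𝟙 (W u ∧ closedNbhd v u) ÷ suc (degreeIn W v)) +ᵘ cwIn W′
          ≃⟨ ℚᵘ.+-congˡ (cwIn W′) (∑ᵘ-÷ (λ u → 𝟙 (W u ∧ closedNbhd v u)) (suc (degreeIn W v))) ⟩
        count (λ u → W u ∧ closedNbhd v u) ÷ suc (degreeIn W v) +ᵘ cwIn W′
          ≡⟨ cong (λ c → c ÷ suc (degreeIn W v) +ᵘ cwIn W′) (count-closedNbhd W v v∈W) ⟩
        suc (degreeIn W v) ÷ suc (degreeIn W v) +ᵘ cwIn W′
          ≃⟨ ℚᵘ.+-congˡ (cwIn W′) (÷-cong (ℕ.*-comm (suc (degreeIn W v)) 1)) ⟩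
        1 ÷ 1 +ᵘ cwIn W′ ∎
        where
        open ℚᵘ.≤-Reasoning
        W′⊆W : W′ ⊆ W
        W′⊆W u u∈W′ = ∧-conicalˡ _ _ u∈W′

      module Insert (T : Fin n → Bool) (T⊆W′ : T ⊆ W′) where

        T⁺ : Fin n → Bool
        T⁺ u = does (u ≟ v) ∨ T u

        T⁺⊆W : T⁺ ⊆ W
        T⁺⊆W u u∈T⁺ with u ≟ v
        ... | yes refl = v∈W
        ... | no _     = ∧-conicalˡ _ _ (T⊆W′ u u∈T⁺)

        count-T⁺ : count T⁺ ≡ suc (count T)
        count-T⁺ = begin
          count T⁺                                        ≡⟨ sum-cong-≗ split ⟩
          ∑[ u < n ] (𝟙 (does (u ≟ v)) + 𝟙 (T u))         ≡⟨ ∑-distrib-+ (λ u → 𝟙 (does (u ≟ v))) _ ⟩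
          ∑[ u < n ] 𝟙 (does (u ≟ v)) + count T           ≡⟨ cong (_+ count T) (∑-𝟙-≟ v) ⟩
          suc (count T)                                   ∎
          where
          open ≡-Reasoning
          v∉T : T v ≡ false
          v∉T = ¬-not λ v∈T → proj₁ (W′⇒∉N[v] (T⊆W′ v v∈T)) refl
          split : ∀ u → 𝟙 (T⁺ u) ≡ 𝟙 (does (u ≟ v)) + 𝟙 (T u)
          split u with u ≟ v
          ... | yes refl rewrite v∉T = refl
          ... | no _     = refl

        T⁺-independent : Independentᵇ T → Independentᵇ T⁺
        T⁺-independent T-indep u w u∈T⁺ w∈T⁺ with u ≟ v | w ≟ v
        ... | yes refl | yes refl = irrefl G u
        ... | yes refl | no _     = proj₂ (W′⇒∉N[v] (T⊆W′ w w∈T⁺))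
        ... | no _     | yes refl = trans (symm G u w) (proj₂ (W′⇒∉N[v] (T⊆W′ u u∈T⁺)))
        ... | no _     | no _     = T-indep u w u∈T⁺ w∈T⁺

    cwIn≤independentSubset : ∀ k W → count W < k → ∃[ T ] (T ⊆ W × Independentᵇ T × cwIn W ≤ᵘ count T ÷ 1)
    cwIn≤independentSubset (suc k) W |W|<k with minimiser W (degreeIn W)
    ... | inj₁ W≡∅ = const false , (λ _ ()) , (λ _ _ ()) , cwIn-∅
      where
      cwIn-∅ : cwIn W ≤ᵘ count {n} (const false) ÷ 1
      cwIn-∅ = ℚᵘ.≤-respʳ-≃ (∑ᵘ-÷ {n} (const 0) 1) (∑ᵘ-mono-≤ term≤0)
        where
        term≤0 : ∀ u → 𝟙 (W u) ÷ suc (degreeIn W u) ≤ᵘ 0 ÷ 1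
        term≤0 u rewrite W≡∅ u = ÷-mono-≤ z≤n
    ... | inj₂ (v , v∈W , v-min) with cwIn≤independentSubset k W′ (ℕ.<-≤-trans |W′|<|W| (ℕ.≤-pred |W|<k))
      where
      open RemoveClosedNbhd W v v∈W
      |W′|<|W| : count W′ < count W
      |W′|<|W| = subst (count W′ <_) (sym count-W) (s≤s (ℕ.m≤n+m (count W′) (degreeIn W v)))
    ...   | T , T⊆W′ , T-indep , T-bound = T⁺ , T⁺⊆W , T⁺-independent T-indep , bound
      where
      open RemoveClosedNbhd W v v∈W
      open Insert T T⊆W′
      bound : cwIn W ≤ᵘ count T⁺ ÷ 1
      bound = begin
        cwIn W                   ≤⟨ cwIn-≤ v-min ⟩
        1 ÷ 1 +ᵘ cwIn W′         ≤⟨ ℚᵘ.+-monoʳ-≤ (1 ÷ 1) T-bound ⟩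
        1 ÷ 1 +ᵘ count T ÷ 1     ≃⟨ ÷-+ 1 (count T) 1 ⟩
        suc (count T) ÷ 1        ≡⟨ cong (_÷ 1) (sym count-T⁺) ⟩
        count T⁺ ÷ 1             ∎
        where open ℚᵘ.≤-Reasoning

    toℚᵘ-CW : toℚᵘ (CW G) ≃ᵘ cwIn (const true)
    toℚᵘ-CW = ℚᵘ.≃-trans (toℚᵘ-foldr-+ (λ v → ℤ.+ 1 ℚ./ suc (degree G v)) (λ v → v)) (∑ᵘ-cong λ v →
      ℚᵘ.≃-trans (toℚᵘ-/ 1 (suc (degree G v))) (ℚᵘ.≃-reflexive (cong (λ d → 1 ÷ suc d) (degree≡count G v))))

    Independentᵇ⇒Independent : ∀ {T} → Independentᵇ T → Independent G (Vec.tabulate T)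
    Independentᵇ⇒Independent {T} T-indep u w u∈T w∈T =
      T-indep u w (trans (sym (Vec.lookup∘tabulate T u)) (Vec.[]=⇒lookup u∈T))
                  (trans (sym (Vec.lookup∘tabulate T w)) (Vec.[]=⇒lookup w∈T))

    Independent⇒Independentᵇ : ∀ {S} → Independent G S → Independentᵇ (lookup S)
    Independent⇒Independentᵇ {S} S-indep u w u∈S w∈S =
      S-indep u w (Vec.lookup⇒[]= u S u∈S) (Vec.lookup⇒[]= w S w∈S)

    CW≤α : ∀ {α} → IsIndependenceNumber G α → CW G ℚ.≤ ℤ.+ α ℚ./ 1
    CW≤α {α} (_ , maximum) with cwIn≤independentSubset (suc (count {n} (const true))) (const true) ℕ.≤-refl
    ... | T , _ , T-indep , bound = ℚ.toℚᵘ-cancel-≤ (begin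
      toℚᵘ (CW G)          ≃⟨ toℚᵘ-CW ⟩
      cwIn (const true)    ≤⟨ bound ⟩
      count T ÷ 1          ≤⟨ ÷-monoˡ-≤ 1 |T|≤α ⟩
      α ÷ 1                ≃⟨ toℚᵘ-/ α 1 ⟨
      toℚᵘ (ℤ.+ α ℚ./ 1)     ∎)
      where
      open ℚᵘ.≤-Reasoning
      |T|≤α : count T ≤ α
      |T|≤α = subst (_≤ α) (∣tabulate∣≡count T) (maximum (Vec.tabulate T) (Independentᵇ⇒Independent T-indep))

    module _ {s : Fin n → Bool} (s-indep : Independentᵇ s) where

      adjacent⇒∉s : ∀ {v u} → s v ≡ true → adj G v u ≡ true → s u ≡ false
      adjacent⇒∉s v∈s vu = ¬-not λ u∈s → contradiction (trans (sym vu) (s-indep _ _ v∈s u∈s)) λ ()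

      ∑-degree-inside≤outside :
        ∑[ v < n ] (𝟙 (s v) * count (adj G v)) ≤ ∑[ v < n ] (𝟙 (not (s v)) * count (adj G v))
      ∑-degree-inside≤outside = begin
        ∑[ v < n ] (𝟙 (s v) * count (adj G v))
          ≡⟨ sum-cong-≗ (λ v → *-distribˡ-sum (𝟙 (s v)) (λ u → 𝟙 (adj G v u))) ⟩
        ∑[ v < n ] ∑[ u < n ] (𝟙 (s v) * 𝟙 (adj G v u))
          ≤⟨ ∑-mono-≤ (λ v → ∑-mono-≤ (λ u → edge-leaves-s v u)) ⟩
        ∑[ v < n ] ∑[ u < n ] (𝟙 (not (s u)) * 𝟙 (adj G u v))
          ≡⟨ ∑-comm (λ v u → 𝟙 (not (s u)) * 𝟙 (adj G u v)) ⟩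
        ∑[ u < n ] ∑[ v < n ] (𝟙 (not (s u)) * 𝟙 (adj G u v))
          ≡⟨ sum-cong-≗ (λ u → *-distribˡ-sum (𝟙 (not (s u))) (λ v → 𝟙 (adj G u v))) ⟨
        ∑[ u < n ] (𝟙 (not (s u)) * count (adj G u)) ∎
        where
        open ℕ.≤-Reasoning
        edge-leaves-s : ∀ v u → 𝟙 (s v) * 𝟙 (adj G v u) ≤ 𝟙 (not (s u)) * 𝟙 (adj G u v)
        edge-leaves-s v u rewrite symm G u v with s v in v∈s | adj G v u in vu
        ... | false | _     = z≤n
        ... | true  | false = z≤n
        ... | true  | true  rewrite adjacent⇒∉s v∈s vu = ℕ.≤-refl

      module _ {Δ} .{{_ : NonZero Δ}} (degree≤Δ : ∀ v → count (adj G v) ≤ Δ) where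

        weight : Fin n → ℕ
        weight v = if s v then Δ + Δ ∸ count (adj G v) else count (adj G v)

        weight-+ : ∀ v → weight v + 𝟙 (s v) * count (adj G v)
                       ≡ (Δ + Δ) * 𝟙 (s v) + 𝟙 (not (s v)) * count (adj G v)
        weight-+ v with s v
        ... | true  = begin
          Δ + Δ ∸ d + (d + 0)   ≡⟨ cong ((Δ + Δ ∸ d) +_) (ℕ.+-identityʳ d) ⟩
          Δ + Δ ∸ d + d         ≡⟨ ℕ.m∸n+n≡m (ℕ.≤-trans (degree≤Δ v) (ℕ.m≤m+n Δ Δ)) ⟩
          Δ + Δ                 ≡⟨ trans (ℕ.+-identityʳ _) (ℕ.*-identityʳ (Δ + Δ)) ⟨
          (Δ + Δ) * 1 + 0       ∎
          where
          open ≡-Reasoning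
          d = count (adj G v)
        ... | false rewrite ℕ.*-zeroʳ (Δ + Δ) = refl

        ∑-weight : (Δ + Δ) * count s ≤ sum weight
        ∑-weight = ℕ.+-cancelʳ-≤ inside _ _ (begin
          (Δ + Δ) * count s + inside
            ≤⟨ ℕ.+-monoʳ-≤ ((Δ + Δ) * count s) ∑-degree-inside≤outside ⟩
          (Δ + Δ) * count s + outside
            ≡⟨ cong (_+ outside) (*-distribˡ-sum (Δ + Δ) (𝟙 ∘ s)) ⟩
          ∑[ v < n ] ((Δ + Δ) * 𝟙 (s v)) + outside
            ≡⟨ ∑-distrib-+ (λ v → (Δ + Δ) * 𝟙 (s v)) _ ⟨
          ∑[ v < n ] ((Δ + Δ) * 𝟙 (s v) + 𝟙 (not (s v)) * count (adj G v))
            ≡⟨ sum-cong-≗ weight-+ ⟨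
          ∑[ v < n ] (weight v + 𝟙 (s v) * count (adj G v))
            ≡⟨ ∑-distrib-+ weight _ ⟩
          sum weight + inside ∎)
          where
          open ℕ.≤-Reasoning
          inside = ∑[ v < n ] (𝟙 (s v) * count (adj G v))
          outside = ∑[ v < n ] (𝟙 (not (s v)) * count (adj G v))

        weight-≤ : ∀ v → weight v * suc (count (adj G v)) ≤ Δ * suc Δ
        weight-≤ v with s v
        ... | true  = [Δ+Δ∸d]*[1+d]≤Δ*[1+Δ] (degree≤Δ v)
        ... | false = ℕ.*-mono-≤ (degree≤Δ v) (s≤s (degree≤Δ v))

        instance
          Δ*[1+Δ]≢0 : NonZero (Δ * suc Δ)
          Δ*[1+Δ]≢0 = ℕ.m*n≢0 Δ (suc Δ)

        2|s|÷[1+Δ]≤cwIn : (2 * count s) ÷ suc Δ ≤ᵘ cwIn (const true)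
        2|s|÷[1+Δ]≤cwIn = begin
          (2 * count s) ÷ suc Δ                  ≃⟨ ÷-cong (rearrange (count s) Δ) ⟩
          ((Δ + Δ) * count s) ÷ (Δ * suc Δ)      ≤⟨ ÷-monoˡ-≤ (Δ * suc Δ) ∑-weight ⟩
          sum weight ÷ (Δ * suc Δ)               ≃⟨ ∑ᵘ-÷ weight (Δ * suc Δ) ⟨
          ∑ᵘ (λ v → weight v ÷ (Δ * suc Δ))      ≤⟨ ∑ᵘ-mono-≤ (λ v → ÷-mono-≤ (weight-≤′ v)) ⟩
          cwIn (const true)                      ∎
          where
          open ℚᵘ.≤-Reasoning
          rearrange : ∀ c Δ → 2 * c * (Δ * suc Δ) ≡ (Δ + Δ) * c * suc Δ
          rearrange = solve-∀
          weight-≤′ : ∀ v → weight v * suc (count (adj G v)) ≤ 1 * (Δ * suc Δ)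
          weight-≤′ v = ℕ.≤-trans (weight-≤ v) (ℕ.≤-reflexive (sym (ℕ.*-identityˡ _)))

    2α÷[1+Δ]≤CW : ∀ {Δ} .{{_ : NonZero Δ}} → (∀ v → degree G v ≤ Δ) → ∀ {α} → IsIndependenceNumber G α →
      (ℤ.+ 2 ℚ./ suc Δ) ℚ.* (ℤ.+ α ℚ./ 1) ℚ.≤ CW G
    2α÷[1+Δ]≤CW {Δ} degree≤Δ ((S , S-indep , refl) , _) = ℚ.toℚᵘ-cancel-≤ (begin
      toℚᵘ ((ℤ.+ 2 ℚ./ suc Δ) ℚ.* (ℤ.+ ∣ S ∣ ℚ./ 1))
        ≃⟨ ℚ.toℚᵘ-homo-* (ℤ.+ 2 ℚ./ suc Δ) (ℤ.+ ∣ S ∣ ℚ./ 1) ⟩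
      toℚᵘ (ℤ.+ 2 ℚ./ suc Δ) *ᵘ toℚᵘ (ℤ.+ ∣ S ∣ ℚ./ 1)
        ≃⟨ ℚᵘ.*-cong (toℚᵘ-/ 2 (suc Δ)) (toℚᵘ-/ ∣ S ∣ 1) ⟩
      2 ÷ suc Δ *ᵘ ∣ S ∣ ÷ 1
        ≡⟨ ÷-* 2 Δ ∣ S ∣ 0 ⟩
      (2 * ∣ S ∣) ÷ (suc Δ * 1)
        ≃⟨ ÷-cong (cong (2 * ∣ S ∣ *_) (sym (ℕ.*-identityʳ (suc Δ)))) ⟩
      (2 * ∣ S ∣) ÷ suc Δ
        ≡⟨ cong (λ c → (2 * c) ÷ suc Δ) (∣∣≡count S) ⟩
      (2 * count (lookup S)) ÷ suc Δ
        ≤⟨ 2|s|÷[1+Δ]≤cwIn (Independent⇒Independentᵇ S-indep) count≤Δ ⟩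
      cwIn (const true)
        ≃⟨ toℚᵘ-CW ⟨
      toℚᵘ (CW G) ∎)
      where
      open ℚᵘ.≤-Reasoning
      count≤Δ : ∀ v → count (adj G v) ≤ Δ
      count≤Δ v = subst (_≤ Δ) (degree≡count G v) (degree≤Δ v)

    count≤nonNeighbours : ∀ {s u} → Independentᵇ s → s u ≡ true → count s ≤ count (λ w → not (adj G u w))
    count≤nonNeighbours s-indep u∈s = ∑-mono-≤ λ w → 𝟙-mono λ w∈s → cong not (s-indep _ w u∈s w∈s)

    CW-regular : ∀ {d} → (∀ v → degree G v ≡ d) → toℚᵘ (CW G) ≃ᵘ n ÷ suc d
    CW-regular {d} regular = begin-equality
      toℚᵘ (CW G)                       ≃⟨ toℚᵘ-CW ⟩
      cwIn (const true)                 ≃⟨ ∑ᵘ-cong (ℚᵘ.≃-reflexive ∘ cong (λ e → 1 ÷ suc e) ∘ degree≡d) ⟩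
      ∑ᵘ {n} (λ _ → 1 ÷ suc d)          ≃⟨ ∑ᵘ-÷ {n} (const 1) (suc d) ⟩
      count {n} (const true) ÷ suc d    ≡⟨ cong (_÷ suc d) (count-const-true n) ⟩
      n ÷ suc d                         ∎
      where
      open ℚᵘ.≤-Reasoning
      degree≡d : ∀ v → count (adj G v) ≡ d
      degree≡d v = trans (sym (degree≡count G v)) (regular v)

  odd : ℕ → Bool
  odd zero          = false
  odd (suc zero)    = true
  odd (suc (suc m)) = odd m

  twice : ℕ → ℕ
  twice zero    = zero
  twice (suc k) = suc (suc (twice k))

  twice≡+ : ∀ k → twice k ≡ k + k
  twice≡+ zero    = refl
  twice≡+ (suc k) = cong suc (trans (cong suc (twice≡+ k)) (sym (ℕ.+-suc k k)))

  completeBipartite : ∀ n → Graph n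
  completeBipartite n = record
    { adj    = λ u v → odd (toℕ u) xor odd (toℕ v)
    ; symm   = λ u v → xor-comm (odd (toℕ u)) (odd (toℕ v))
    ; irrefl = λ v → xor-same (odd (toℕ v))
    }

  count-xor-odd : ∀ k b → count (λ (u : Fin (twice k)) → b xor odd (toℕ u)) ≡ k
  count-xor-odd zero    b     = refl
  count-xor-odd (suc k) true  = cong suc (count-xor-odd k true)
  count-xor-odd (suc k) false = cong suc (count-xor-odd k false)

  degree-completeBipartite : ∀ k v → degree (completeBipartite (twice k)) v ≡ k
  degree-completeBipartite k v = trans (degree≡count (completeBipartite (twice k)) v) (count-xor-odd k (odd (toℕ v)))

  α-completeBipartite : ∀ k → IsIndependenceNumber (completeBipartite (twice k)) k
  α-completeBipartite k = (Vec.tabulate isEven , Independentᵇ⇒Independent K evens-independent , |evens|≡k) , maximal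
    where
    K = completeBipartite (twice k)
    isEven : Fin (twice k) → Bool
    isEven u = not (odd (toℕ u))
    evens-independent : Independentᵇ K isEven
    evens-independent u w u-even w-even = cong₂ _xor_ (not-injective {y = false} u-even) (not-injective {y = false} w-even)
    |evens|≡k : ∣ Vec.tabulate isEven ∣ ≡ k
    |evens|≡k = trans (∣tabulate∣≡count isEven) (count-xor-odd k true)
    maximal : ∀ S → Independent K S → ∣ S ∣ ≤ k
    maximal S S-indep with any? (λ u → lookup S u Bool.≟ true)
    ... | yes (u , u∈S) = begin
      ∣ S ∣
        ≡⟨ ∣∣≡count S ⟩
      count (lookup S)
        ≤⟨ count≤nonNeighbours K (Independent⇒Independentᵇ K S-indep) u∈S ⟩
      count {twice k} (λ w → not (adj K u w))
        ≡⟨ sum-cong-≗ {twice k} (λ w → cong 𝟙 (not-distribˡ-xor (odd (toℕ u)) (odd (toℕ w)))) ⟩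
      count {twice k} (λ w → not (odd (toℕ u)) xor odd (toℕ w))
        ≡⟨ count-xor-odd k (not (odd (toℕ u))) ⟩
      k ∎
      where open ℕ.≤-Reasoning
    ... | no ∄u∈S = subst (_≤ k) (sym (trans (∣∣≡count S) (count-∅ S-empty))) z≤n
      where
      S-empty : ∀ u → lookup S u ≡ false
      S-empty u = ¬-not λ u∈S → ∄u∈S (u , u∈S)

  completeBipartite-tight : ∀ k → ℤ.+ k ℚ./ 1 ≡ (ℤ.+ suc k ℚ./ 2) ℚ.* CW (completeBipartite (twice k))
  completeBipartite-tight k = ℚ.toℚᵘ-injective (begin-equality
    toℚᵘ (ℤ.+ k ℚ./ 1)
      ≃⟨ toℚᵘ-/ k 1 ⟩
    k ÷ 1
      ≃⟨ ÷-cong rearrange ⟩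
    (suc k * twice k) ÷ (2 * suc k)
      ≡⟨ ÷-* (suc k) 1 (twice k) k ⟨
    suc k ÷ 2 *ᵘ twice k ÷ suc k
      ≃⟨ ℚᵘ.*-cong (toℚᵘ-/ (suc k) 2) (CW-regular K (degree-completeBipartite k)) ⟨
    toℚᵘ (ℤ.+ suc k ℚ./ 2) *ᵘ toℚᵘ (CW K)
      ≃⟨ ℚ.toℚᵘ-homo-* (ℤ.+ suc k ℚ./ 2) (CW K) ⟨
    toℚᵘ ((ℤ.+ suc k ℚ./ 2) ℚ.* CW K) ∎)
    where
    open ℚᵘ.≤-Reasoning
    K = completeBipartite (twice k)
    rearrange : k * (2 * suc k) ≡ suc k * twice k * 1
    rearrange rewrite twice≡+ k = identity k
      where
      identity : ∀ k → k * (2 * suc k) ≡ suc k * (k + k) * 1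
      identity = solve-∀

open import Defs
open import Data.Nat using (ℕ; suc; _≥_; _≤_)
open import Data.Nat.Properties using (≤-reflexive)
open import Data.Integer using (+_)
open import Data.Rational using (ℚ; _/_; _*_) renaming (_≤_ to _≤ℚ_)
open import Data.Product using (Σ; ∃; _×_; _,_)
open import Data.Fin using (zero)
open import Relation.Binary.PropositionalEquality using (_≡_)
open CaroWei
  using ( CW≤α; 2α÷[1+Δ]≤CW; twice; completeBipartite; degree-completeBipartite
        ; α-completeBipartite; completeBipartite-tight)

mainTheorem1 : (Δ : ℕ) → Δ ≥ 1 →
    ((n : ℕ) (G : Graph n) → HasMaxDegree G Δ → (α : ℕ) → IsIndependenceNumber G α →
      (CW G ≤ℚ ((+ α) / 1)) × ((((+ 2) / suc Δ) * ((+ α) / 1)) ≤ℚ CW G))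
    × (∃ λ (n : ℕ) → Σ (Graph n) λ G → HasMaxDegree G Δ × (∃ λ (α : ℕ) →
      IsIndependenceNumber G α × ((+ α) / 1 ≡ ((+ suc Δ) / 2) * CW G)))
mainTheorem1 Δ@(suc _) _ =
    (λ n G (degree≤Δ , _) α α-is-α → CW≤α G α-is-α , 2α÷[1+Δ]≤CW G degree≤Δ α-is-α)
  , ( twice Δ , completeBipartite (twice Δ)
    , ((λ v → ≤-reflexive (degree-completeBipartite Δ v)) , zero , degree-completeBipartite Δ zero)
    , Δ , α-completeBipartite Δ , completeBipartite-tight Δ)
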